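{- Let $n\equiv 0\pmod{4}$ be a positive integer, and write $\frac{n}{4}=\overline{P}_n\cdot\overline{Q}_n^2$ with $\overline{P}_n$ squarefree and $\overline{Q}_n$ a positive integer. Then \[ f(n)=-\frac{n}{8}+\overline{Q}_n+\frac{1}{n}\sum_{k=1}^{n/2}\mathrm{Rem}(k^2\div n). \]
   Context: For a positive integer $n$, $f(n):=\sum_{j=1}^{\lfloor n/4\rfloor}\lfloor\sqrt{jn}\rfloor-\frac{n^2-1}{12}$, where $\lfloor x\rfloor$ is the floor function. For integers $a\geq 0$, $b\geq 1$, $\mathrm{Rem}(a\div b)$ denotes the smallest nonnegative remainder of $a$ upon division by $b$. -}

module Defs where

open import Data.Nat using (ℕ; zero; suc; _+_; _*_; _∸_; _≤?_; NonZero)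
open import Data.Nat.DivMod using (_/_; _%_)
open import Data.Nat.Divisibility using (_∣_)
open import Data.Integer using (ℤ; +_)
import Data.Integer as ℤ
open import Data.Rational using (ℚ)
import Data.Rational as ℚ
open import Relation.Binary.PropositionalEquality using (_≡_)
open import Relation.Nullary using (yes; no)

isqrtFrom : ℕ → ℕ → ℕ
isqrtFrom x zero = zero
isqrtFrom x (suc k) with suc k * suc k ≤? x
... | yes _ = suc k
... | no _ = isqrtFrom x k

-- floor of the square root: ⌊√x⌋ (note ⌊√x⌋ ≤ x)
isqrt : ℕ → ℕ
isqrt x = isqrtFrom x x

sum1 : ℕ → (ℕ → ℕ) → ℕ
sum1 zero g = zero
sum1 (suc m) g = sum1 m g + g (suc m)

SquareFree : ℕ → Set
SquareFree p = ∀ d → d * d ∣ p → d ≡ 1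

ℕtoℚ : ℕ → ℚ
ℕtoℚ a = (+ a) ℚ./ 1

f : ℕ → ℚ
f n = ℕtoℚ (sum1 (n / 4) (λ j → isqrt (j * n)))
      ℚ.- ((+ (n * n) ℤ.- + 1) ℚ./ 12)

remSum : (n : ℕ) → .{{NonZero n}} → ℕ
remSum n = sum1 (n / 2) (λ k → (k * k) % n)

-- Write n = 4m. The sum S = Σ_{j ≤ m} ⌊√(jn)⌋ counts the lattice points (j, k) with 1 ≤ j ≤ m,
-- 1 ≤ k ≤ 2m and k² ≤ jn; counted by rows, the complementary points number X = Σ_{k ≤ 2m} (⌈k²/n⌉ − 1),
-- so S + X = 2m². Dividing k² by n, Σ_{k ≤ 2m} k² = nX + R + nZ, where R = Σ Rem(k² ÷ n) and Z is the
-- number of k ≤ 2m with n ∣ k². As n = P(2Q)² with P squarefree, n ∣ k² iff 2PQ ∣ k, so Z = Q.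
-- The closed form of Σ k² then leaves a polynomial identity between S, R, Q and n.

module Submission where

open import Defs

open import Data.Empty using (⊥-elim)
open import Data.Integer using (+_)
import Data.Integer as ℤ
import Data.Integer.Properties as ℤP
import Data.Integer.Tactic.RingSolver as ℤSolver
import Data.Nat as ℕ
open import Data.Nat.Coprimality using (Coprime; coprime-/gcd; coprime-divisor)
open import Data.Nat.DivMod
open import Data.Nat.Divisibility
open import Data.Nat.GCD using (gcd; gcd[m,n]∣m; gcd[m,n]∣n; gcd[m,n]≢0)
open import Data.Nat.Properties
open import Data.Nat.Tactic.RingSolver using (solve-∀)
open import Data.Product using (_,_; _×_; ∃-syntax)
import Data.Rational as ℚ
import Data.Rational.Properties as ℚP
open import Data.Rational.Unnormalised as ℚᵘ using (mkℚᵘ; *≡*; _≃_)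
import Data.Rational.Unnormalised.Properties as ℚᵘP
open import Data.Sum using (inj₁; inj₂)
open import Relation.Binary.PropositionalEquality
open import Relation.Nullary using (Dec; yes; no; ¬_)

-- S − (n² − 1)/12 = −n/8 + Q + R/n, multiplied by 24n and rearranged to avoid subtraction.
ClearedIdentity : ℕ.ℕ → ℕ.ℕ → ℕ.ℕ → ℕ.ℕ → Set
ClearedIdentity n S R Q =
  n ℕ.* (24 ℕ.* S ℕ.+ (n ℕ.+ 1) ℕ.* (n ℕ.+ 2)) ≡
  n ℕ.* (3 ℕ.* (n ℕ.* n) ℕ.+ 24 ℕ.* Q) ℕ.+ 24 ℕ.* R

module _ (n S R Q : ℕ.ℕ) where

  open ℤ using (_+_; _*_; -_; _-_)
  open ≡-Reasoning

  private
    N = + n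

  cleared-identity⇒ℤ : ClearedIdentity n S R Q →
    N * (+ 24 * + S + (N + + 1) * (N + + 2)) ≡ N * (+ 3 * (N * N) + + 24 * + Q) + + 24 * + R
  cleared-identity⇒ℤ eq = begin
    N * (+ 24 * + S + (N + + 1) * (N + + 2))
      ≡⟨ sym (trans (ℤP.pos-* n _) (cong (N *_) (trans (ℤP.pos-+ (24 ℕ.* S) _)
           (cong₂ _+_ (ℤP.pos-* 24 S) (trans (ℤP.pos-* (n ℕ.+ 1) (n ℕ.+ 2))
             (cong₂ _*_ (ℤP.pos-+ n 1) (ℤP.pos-+ n 2))))))) ⟩
    + (n ℕ.* (24 ℕ.* S ℕ.+ (n ℕ.+ 1) ℕ.* (n ℕ.+ 2)))
      ≡⟨ cong +_ eq ⟩
    + (n ℕ.* (3 ℕ.* (n ℕ.* n) ℕ.+ 24 ℕ.* Q) ℕ.+ 24 ℕ.* R)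
      ≡⟨ trans (ℤP.pos-+ (n ℕ.* (3 ℕ.* (n ℕ.* n) ℕ.+ 24 ℕ.* Q)) (24 ℕ.* R)) (cong₂ _+_
           (trans (ℤP.pos-* n _) (cong (N *_) (trans (ℤP.pos-+ (3 ℕ.* (n ℕ.* n)) _)
             (cong₂ _+_ (trans (ℤP.pos-* 3 (n ℕ.* n)) (cong (+ 3 *_) (ℤP.pos-* n n))) (ℤP.pos-* 24 Q)))))
           (ℤP.pos-* 24 R)) ⟩
    N * (+ 3 * (N * N) + + 24 * + Q) + + 24 * + R ∎

  -- ↥ p * ↧ q ≡ ↥ q * ↧ p for the two sides of cleared-identity⇒ℚ, read as unnormalised fractions.
  cross-multiplied-identity : ClearedIdentity n S R Q →
    (+ S * + 12 + (- (N * N - + 1)) * + 1) * (+ 8 * N) ≡ (((- N) * + 1 + + Q * + 8) * N + + R * + 8) * + 12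
  cross-multiplied-identity eq = begin
    (+ S * + 12 + (- (N * N - + 1)) * + 1) * (+ 8 * N)
      ≡⟨ left (+ S) N ⟩
    + 4 * (N * (+ 24 * + S + (N + + 1) * (N + + 2))) + rest
      ≡⟨ cong (λ v → + 4 * v + rest) (cleared-identity⇒ℤ eq) ⟩
    + 4 * (N * (+ 3 * (N * N) + + 24 * + Q) + + 24 * + R) + rest
      ≡⟨ right (+ Q) (+ R) N ⟩
    (((- N) * + 1 + + Q * + 8) * N + + R * + 8) * + 12 ∎
    where
    rest = - (+ 8 * (N * N * N)) + + 8 * N - + 4 * (N * (N + + 1) * (N + + 2))
    left : ∀ S N → (S * + 12 + (- (N * N - + 1)) * + 1) * (+ 8 * N) ≡
      + 4 * (N * (+ 24 * S + (N + + 1) * (N + + 2)))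
        + (- (+ 8 * (N * N * N)) + + 8 * N - + 4 * (N * (N + + 1) * (N + + 2)))
    left = ℤSolver.solve-∀
    right : ∀ Q R N →
      + 4 * (N * (+ 3 * (N * N) + + 24 * Q) + + 24 * R)
        + (- (+ 8 * (N * N * N)) + + 8 * N - + 4 * (N * (N + + 1) * (N + + 2)))
      ≡ (((- N) * + 1 + Q * + 8) * N + R * + 8) * + 12
    right = ℤSolver.solve-∀

toℚᵘ-/ : ∀ i d .{{_ : ℕ.NonZero d}} → ℚ.toℚᵘ (i ℚ./ d) ≃ i ℚᵘ./ d
toℚᵘ-/ i (ℕ.suc d) = ℚP.toℚᵘ-fromℚᵘ (mkℚᵘ i d)

cleared-identity⇒ℚ : ∀ n .{{_ : ℕ.NonZero n}} S R Q → ClearedIdentity n S R Q →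
  ℕtoℚ S ℚ.- ((+ (n ℕ.* n) ℤ.- + 1) ℚ./ 12) ≡ ℚ.- ((+ n) ℚ./ 8) ℚ.+ ℕtoℚ Q ℚ.+ ((+ R) ℚ./ n)
cleared-identity⇒ℚ n@(ℕ.suc _) S R Q eq = ℚP.toℚᵘ-injective (begin
  ℚ.toℚᵘ (ℕtoℚ S ℚ.- a)
    ≈⟨ ℚP.toℚᵘ-homo-+ (ℕtoℚ S) (ℚ.- a) ⟩
  ℚ.toℚᵘ (ℕtoℚ S) ℚᵘ.+ ℚ.toℚᵘ (ℚ.- a)
    ≈⟨ ℚᵘP.+-cong (toℚᵘ-/ (+ S) 1)
         (ℚᵘP.≃-trans (ℚP.toℚᵘ-homo‿- a) (ℚᵘP.-‿cong (toℚᵘ-/ (+ (n ℕ.* n) ℤ.- + 1) 12))) ⟩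
  (+ S ℚᵘ./ 1) ℚᵘ.- ((+ (n ℕ.* n) ℤ.- + 1) ℚᵘ./ 12)
    ≈⟨ *≡* (cross-multiplied-identity n S R Q eq) ⟩
  ℚᵘ.- (+ n ℚᵘ./ 8) ℚᵘ.+ (+ Q ℚᵘ./ 1) ℚᵘ.+ (+ R ℚᵘ./ n)
    ≈⟨ ℚᵘP.+-cong (ℚᵘP.+-cong (ℚᵘP.-‿cong (toℚᵘ-/ (+ n) 8)) (toℚᵘ-/ (+ Q) 1))
                  (toℚᵘ-/ (+ R) n) ⟨
  ℚᵘ.- ℚ.toℚᵘ b ℚᵘ.+ ℚ.toℚᵘ (ℕtoℚ Q) ℚᵘ.+ ℚ.toℚᵘ c
    ≈⟨ ℚᵘP.+-cong (ℚᵘP.+-cong (ℚP.toℚᵘ-homo‿- b) ℚᵘP.≃-refl) ℚᵘP.≃-refl ⟨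
  ℚ.toℚᵘ (ℚ.- b) ℚᵘ.+ ℚ.toℚᵘ (ℕtoℚ Q) ℚᵘ.+ ℚ.toℚᵘ c
    ≈⟨ ℚᵘP.+-cong (ℚP.toℚᵘ-homo-+ (ℚ.- b) (ℕtoℚ Q)) ℚᵘP.≃-refl ⟨
  ℚ.toℚᵘ (ℚ.- b ℚ.+ ℕtoℚ Q) ℚᵘ.+ ℚ.toℚᵘ c
    ≈⟨ ℚP.toℚᵘ-homo-+ (ℚ.- b ℚ.+ ℕtoℚ Q) c ⟨
  ℚ.toℚᵘ (ℚ.- b ℚ.+ ℕtoℚ Q ℚ.+ c) ∎)
  where
  open ℚᵘP.≃-Reasoning
  a = (+ (n ℕ.* n) ℤ.- + 1) ℚ./ 12
  b = (+ n) ℚ./ 8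
  c = (+ R) ℚ./ n

open import Data.Nat

open ≡-Reasoning

sum1-cong : ∀ m {g h : ℕ → ℕ} → (∀ j → 1 ≤ j → j ≤ m → g j ≡ h j) → sum1 m g ≡ sum1 m h
sum1-cong zero    eq = refl
sum1-cong (suc m) eq =
  cong₂ _+_ (sum1-cong m λ j 1≤j j≤m → eq j 1≤j (m≤n⇒m≤1+n j≤m)) (eq (suc m) (s≤s z≤n) ≤-refl)

sum1-+ : ∀ m (g h : ℕ → ℕ) → sum1 m (λ j → g j + h j) ≡ sum1 m g + sum1 m h
sum1-+ zero    g h = refl
sum1-+ (suc m) g h =
  trans (cong (_+ (g (suc m) + h (suc m))) (sum1-+ m g h))
        (+-interchange (sum1 m g) (sum1 m h) (g (suc m)) (h (suc m)))
  where
  +-interchange : ∀ a b c d → a + b + (c + d) ≡ a + c + (b + d)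
  +-interchange = solve-∀

sum1-*ˡ : ∀ m c (g : ℕ → ℕ) → sum1 m (λ j → c * g j) ≡ c * sum1 m g
sum1-*ˡ zero    c g = sym (*-zeroʳ c)
sum1-*ˡ (suc m) c g =
  trans (cong (_+ c * g (suc m)) (sum1-*ˡ m c g)) (sym (*-distribˡ-+ c _ _))

sum1-const : ∀ m c → sum1 m (λ _ → c) ≡ m * c
sum1-const zero    c = refl
sum1-const (suc m) c = trans (cong (_+ c) (sum1-const m c)) (+-comm (m * c) c)

sum1-swap : ∀ m n (g : ℕ → ℕ → ℕ) →
  sum1 m (λ j → sum1 n (g j)) ≡ sum1 n (λ k → sum1 m (λ j → g j k))
sum1-swap zero    n g = sym (trans (sum1-const n 0) (*-zeroʳ n))
sum1-swap (suc m) n g =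
  trans (cong (_+ sum1 n (g (suc m))) (sum1-swap m n g))
        (sym (sum1-+ n (λ k → sum1 m (λ j → g j k)) (g (suc m))))

sum1-+-range : ∀ a b (g : ℕ → ℕ) → sum1 (a + b) g ≡ sum1 a g + sum1 b (λ i → g (a + i))
sum1-+-range a zero    g = trans (cong (λ x → sum1 x g) (+-identityʳ a)) (sym (+-identityʳ _))
sum1-+-range a (suc b) g rewrite +-suc a b =
  trans (cong (_+ g (suc (a + b))) (sum1-+-range a b g)) (+-assoc (sum1 a g) _ _)

χ : ∀ {p} {P : Set p} → Dec P → ℕ
χ (yes _) = 1
χ (no _)  = 0

χ-cong : ∀ {P Q : Set} → (P → Q) → (Q → P) → (p : Dec P) (q : Dec Q) → χ p ≡ χ q
χ-cong to from (yes _) (yes _) = refl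
χ-cong to from (yes p) (no ¬q) = ⊥-elim (¬q (to p))
χ-cong to from (no ¬p) (yes q) = ⊥-elim (¬p (from q))
χ-cong to from (no _)  (no _)  = refl

χ-yes : ∀ {P : Set} → P → (p : Dec P) → χ p ≡ 1
χ-yes x (yes _) = refl
χ-yes x (no ¬x) = ⊥-elim (¬x x)

χ-no : ∀ {P : Set} → ¬ P → (p : Dec P) → χ p ≡ 0
χ-no ¬x (yes x) = ⊥-elim (¬x x)
χ-no ¬x (no _)  = refl

count-≤ : ∀ m s → sum1 m (λ k → χ (k ≤? s)) ≡ m ⊓ s
count-≤ zero    s = refl
count-≤ (suc m) s with suc m ≤? s
... | yes 1+m≤s = begin
  sum1 m (λ k → χ (k ≤? s)) + 1  ≡⟨ cong (_+ 1) (trans (count-≤ m s) (m≤n⇒m⊓n≡m (<⇒≤ 1+m≤s))) ⟩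
  m + 1                          ≡⟨ +-comm m 1 ⟩
  suc m                          ≡⟨ sym (m≤n⇒m⊓n≡m 1+m≤s) ⟩
  suc m ⊓ s                      ∎
... | no 1+m≰s = begin
  sum1 m (λ k → χ (k ≤? s)) + 0  ≡⟨ +-identityʳ _ ⟩
  sum1 m (λ k → χ (k ≤? s))      ≡⟨ count-≤ m s ⟩
  m ⊓ s                          ≡⟨ m≥n⇒m⊓n≡n s≤m ⟩
  s                              ≡⟨ sym (m≥n⇒m⊓n≡n (m≤n⇒m≤1+n s≤m)) ⟩
  suc m ⊓ s                      ∎
  where s≤m = ≤-pred (≰⇒> 1+m≰s)

count-> : ∀ m t → sum1 m (λ j → χ (t <? j)) ≡ m ∸ t
count-> zero    t = sym (0∸n≡0 t)
count-> (suc m) t with t <? suc m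
... | yes t<1+m =
  trans (cong (_+ 1) (count-> m t)) (trans (sym (+-∸-comm 1 (≤-pred t<1+m))) (cong (_∸ t) (+-comm m 1)))
... | no t≮1+m =
  trans (+-identityʳ _) (trans (count-> m t)
    (trans (m≤n⇒m∸n≡0 (≤-trans (n≤1+n m) (≮⇒≥ t≮1+m)))
           (sym (m≤n⇒m∸n≡0 (≮⇒≥ t≮1+m)))))

count-multiples : ∀ d Q .{{_ : NonZero d}} → sum1 (d * Q) (λ k → χ (d ∣? k)) ≡ Q
count-multiples d zero = cong (λ x → sum1 x (λ k → χ (d ∣? k))) (*-zeroʳ d)
count-multiples d@(suc d-1) (suc Q) = begin
  sum1 (d * suc Q) (λ k → χ (d ∣? k))
    ≡⟨ cong (λ x → sum1 x (λ k → χ (d ∣? k))) (trans (*-suc d Q) (+-comm d (d * Q))) ⟩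
  sum1 (d * Q + d) (λ k → χ (d ∣? k))
    ≡⟨ sum1-+-range (d * Q) d _ ⟩
  sum1 (d * Q) (λ k → χ (d ∣? k)) + sum1 d (λ i → χ (d ∣? (d * Q + i)))
    ≡⟨ cong₂ _+_ (count-multiples d Q) last-block ⟩
  Q + 1
    ≡⟨ +-comm Q 1 ⟩
  suc Q ∎
  where
  -- of dQ + 1, …, dQ + d only the last is a multiple of d
  last-block : sum1 d (λ i → χ (d ∣? (d * Q + i))) ≡ 1
  last-block = cong₂ _+_
    (trans (sum1-cong d-1 λ i 1≤i i<d → χ-no (λ d∣ → <⇒≱ (s≤s i<d)
             (∣⇒≤ {{>-nonZero 1≤i}} (∣m+n∣m⇒∣n d∣ (m∣m*n Q)))) (d ∣? (d * Q + i)))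
           (trans (sum1-const d-1 0) (*-zeroʳ d-1)))
    (χ-yes (∣m∣n⇒∣m+n (m∣m*n Q) ∣-refl) (d ∣? (d * Q + d)))

m≤m*m : ∀ m → m ≤ m * m
m≤m*m zero    = z≤n
m≤m*m (suc m) = m≤m*n (suc m) (suc m)

m*m≤n*n⇒m≤n : ∀ {m n} → m * m ≤ n * n → m ≤ n
m*m≤n*n⇒m≤n {m} {n} mm≤nn with m ≤? n
... | yes m≤n = m≤n
... | no m≰n  = ⊥-elim (<⇒≱ (*-mono-< (≰⇒> m≰n) (≰⇒> m≰n)) mm≤nn)

isqrtFrom-sq≤ : ∀ x k → isqrtFrom x k * isqrtFrom x k ≤ x
isqrtFrom-sq≤ x zero = z≤n
isqrtFrom-sq≤ x (suc k) with suc k * suc k ≤? x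
... | yes kk≤x = kk≤x
... | no _     = isqrtFrom-sq≤ x k

isqrtFrom-greatest : ∀ x k j → j ≤ k → j * j ≤ x → j ≤ isqrtFrom x k
isqrtFrom-greatest x zero    j j≤k jj≤x = j≤k
isqrtFrom-greatest x (suc k) j j≤k jj≤x with suc k * suc k ≤? x
... | yes _ = j≤k
... | no kk≰x with m≤n⇒m<n∨m≡n j≤k
...   | inj₁ j<1+k = isqrtFrom-greatest x k j (≤-pred j<1+k) jj≤x
...   | inj₂ refl  = ⊥-elim (kk≰x jj≤x)

isqrt-sq≤ : ∀ x → isqrt x * isqrt x ≤ x
isqrt-sq≤ x = isqrtFrom-sq≤ x x

isqrt-greatest : ∀ x j → j * j ≤ x → j ≤ isqrt x
isqrt-greatest x j jj≤x = isqrtFrom-greatest x x j (≤-trans (m≤m*m j) jj≤x) jj≤x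

count-sq≤≡isqrt : ∀ x m → isqrt x ≤ m → sum1 m (λ k → χ (k * k ≤? x)) ≡ isqrt x
count-sq≤≡isqrt x m isqrt≤m = begin
  sum1 m (λ k → χ (k * k ≤? x))
    ≡⟨ sum1-cong m (λ k _ _ → χ-cong (isqrt-greatest x k)
                    (λ k≤ → ≤-trans (*-mono-≤ k≤ k≤) (isqrt-sq≤ x)) (k * k ≤? x) (k ≤? isqrt x)) ⟩
  sum1 m (λ k → χ (k ≤? isqrt x)) ≡⟨ count-≤ m (isqrt x) ⟩
  m ⊓ isqrt x                     ≡⟨ m≥n⇒m⊓n≡n isqrt≤m ⟩
  isqrt x                         ∎

module _ {n : ℕ} .{{_ : NonZero n}} where

  m≤n/o⇒m*o≤n : ∀ {j x} → j ≤ x / n → j * n ≤ x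
  m≤n/o⇒m*o≤n {j} {x} j≤ = ≤-trans (*-monoˡ-≤ n j≤) (m/n*n≤m x n)

  m*o≤n⇒m≤n/o : ∀ {j x} → j * n ≤ x → j ≤ x / n
  m*o≤n⇒m≤n/o {j} jn≤x = subst (_≤ _) (m*n/n≡m j n) (/-monoˡ-≤ n jn≤x)

  <⇒≤pred/ : ∀ {j x} → j * n < x → j ≤ pred x / n
  <⇒≤pred/ jn<x = m*o≤n⇒m≤n/o (<⇒≤pred jn<x)

  ≤pred/⇒< : ∀ {j x} .{{_ : NonZero x}} → j ≤ pred x / n → j * n < x
  ≤pred/⇒< j≤ = m≤pred[n]⇒suc[m]≤n (m≤n/o⇒m*o≤n j≤)

  -- For x ≥ 1, pred x / n = ⌈x / n⌉ − 1, which is x / n unless n ∣ x.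
  pred-quot-rem : ∀ x .{{_ : NonZero x}} → x ≡ n * (pred x / n) + x % n + n * χ (x % n ≟ 0)
  pred-quot-rem (suc y) with m≤n⇒m<n∨m≡n (m%n<n y n)
  ... | inj₁ 1+r<n = begin
    suc y                              ≡⟨ 1+y≡ ⟩
    suc (y % n) + y / n * n            ≡⟨ shuffle (y % n) (y / n) n ⟩
    n * (y / n) + suc (y % n) + n * 0  ≡⟨ cong₂ (λ r z → n * (y / n) + r + n * z) rem carry ⟨
    n * (y / n) + suc y % n + n * χ (suc y % n ≟ 0) ∎
    where
    1+y≡ = cong suc (m≡m%n+[m/n]*n y n)
    rem : suc y % n ≡ suc (y % n)
    rem = trans (cong (_% n) 1+y≡) (trans ([m+kn]%n≡m%n (suc (y % n)) (y / n) n) (m<n⇒m%n≡m 1+r<n))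
    carry : χ (suc y % n ≟ 0) ≡ 0
    carry = χ-no (λ r≡0 → 1+n≢0 (trans (sym rem) r≡0)) (suc y % n ≟ 0)
    shuffle : ∀ r q n → suc r + q * n ≡ n * q + suc r + n * 0
    shuffle = solve-∀
  ... | inj₂ 1+r≡n = begin
    suc y                              ≡⟨ 1+y≡ ⟩
    n + y / n * n                      ≡⟨ shuffle (y / n) n ⟩
    n * (y / n) + 0 + n * 1            ≡⟨ cong₂ (λ r z → n * (y / n) + r + n * z) rem carry ⟨
    n * (y / n) + suc y % n + n * χ (suc y % n ≟ 0) ∎
    where
    1+y≡ = trans (cong suc (m≡m%n+[m/n]*n y n)) (cong (_+ y / n * n) 1+r≡n)
    rem : suc y % n ≡ 0
    rem = trans (cong (_% n) 1+y≡) (trans ([m+kn]%n≡m%n n (y / n) n) (n%n≡0 n))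
    carry : χ (suc y % n ≟ 0) ≡ 1
    carry = χ-yes rem (suc y % n ≟ 0)
    shuffle : ∀ q n → n + q * n ≡ n * q + 0 + n * 1
    shuffle = solve-∀

  -- Counting the lattice points (j, k), 1 ≤ j ≤ m, 1 ≤ k ≤ N, by columns and by rows:
  -- k² ≤ j n holds for isqrt (j n) values of k, and fails for pred (k²) / n values of j.
  lattice-count : ∀ N m → N * N ≡ m * n →
    sum1 m (λ j → isqrt (j * n)) + sum1 N (λ k → pred (k * k) / n) ≡ N * m
  lattice-count N m NN≡mn = begin
    sum1 m (λ j → isqrt (j * n)) + T
      ≡⟨ cong (_+ T) (sum1-cong m λ j _ j≤m → sym (count-sq≤≡isqrt (j * n) N (isqrt≤N j≤m))) ⟩
    sum1 m (λ j → sum1 N (λ k → χ (k * k ≤? j * n))) + T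
      ≡⟨ cong (_+ T) (sum1-swap m N _) ⟩
    sum1 N (λ k → sum1 m (λ j → χ (k * k ≤? j * n))) + T
      ≡⟨ sym (sum1-+ N _ _) ⟩
    sum1 N (λ k → sum1 m (λ j → χ (k * k ≤? j * n)) + pred (k * k) / n)
      ≡⟨ sum1-cong N row ⟩
    sum1 N (λ _ → m)
      ≡⟨ sum1-const N m ⟩
    N * m ∎
    where
    T = sum1 N (λ k → pred (k * k) / n)

    isqrt≤N : ∀ {j} → j ≤ m → isqrt (j * n) ≤ N
    isqrt≤N j≤m = m*m≤n*n⇒m≤n
      (≤-trans (isqrt-sq≤ _) (≤-trans (*-monoˡ-≤ n j≤m) (≤-reflexive (sym NN≡mn))))

    row : ∀ k → 1 ≤ k → k ≤ N → sum1 m (λ j → χ (k * k ≤? j * n)) + pred (k * k) / n ≡ m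
    row (suc k) _ k≤N = begin
      sum1 m (λ j → χ (K ≤? j * n)) + t
        ≡⟨ cong (_+ t) (sum1-cong m λ j _ _ → χ-cong to from (K ≤? j * n) (t <? j)) ⟩
      sum1 m (λ j → χ (t <? j)) + t
        ≡⟨ cong (_+ t) (count-> m t) ⟩
      m ∸ t + t
        ≡⟨ m∸n+n≡m (<⇒≤ t<m) ⟩
      m ∎
      where
      K = suc k * suc k
      t = pred K / n
      to : ∀ {j} → K ≤ j * n → t < j
      to K≤jn = ≰⇒> λ j≤t → <⇒≱ (≤pred/⇒< j≤t) K≤jn
      from : ∀ {j} → t < j → K ≤ j * n
      from t<j = ≮⇒≥ λ jn<K → <⇒≱ t<j (<⇒≤pred/ jn<K)
      t<m : t < m
      t<m = *-cancelʳ-< n t m (<-≤-trans (≤pred/⇒< ≤-refl)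
              (≤-trans (*-mono-≤ k≤N k≤N) (≤-reflexive NN≡mn)))

  sum-squares-by-residues : ∀ N →
    sum1 N (λ k → k * k) ≡
      n * sum1 N (λ k → pred (k * k) / n) + sum1 N (λ k → k * k % n)
        + n * sum1 N (λ k → χ (k * k % n ≟ 0))
  sum-squares-by-residues N = begin
    sum1 N (λ k → k * k)
      ≡⟨ sum1-cong N (λ { (suc k) _ _ → pred-quot-rem (suc k * suc k) }) ⟩
    sum1 N (λ k → n * (pred (k * k) / n) + k * k % n + n * χ (k * k % n ≟ 0))
      ≡⟨ sum1-+ N _ _ ⟩
    sum1 N (λ k → n * (pred (k * k) / n) + k * k % n) + sum1 N (λ k → n * χ (k * k % n ≟ 0))
      ≡⟨ cong₂ _+_ (trans (sum1-+ N _ _) (cong (_+ sum1 N (λ k → k * k % n)) (sum1-*ˡ N n _)))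
                   (sum1-*ˡ N n _) ⟩
    n * sum1 N (λ k → pred (k * k) / n) + sum1 N (λ k → k * k % n)
      + n * sum1 N (λ k → χ (k * k % n ≟ 0)) ∎

sum-squares : ∀ N → 6 * sum1 N (λ k → k * k) ≡ N * (N + 1) * (2 * N + 1)
sum-squares zero    = refl
sum-squares (suc N) = begin
  6 * (sum1 N (λ k → k * k) + suc N * suc N)      ≡⟨ *-distribˡ-+ 6 (sum1 N (λ k → k * k)) _ ⟩
  6 * sum1 N (λ k → k * k) + 6 * (suc N * suc N)  ≡⟨ cong (_+ 6 * (suc N * suc N)) (sum-squares N) ⟩
  N * (N + 1) * (2 * N + 1) + 6 * (suc N * suc N) ≡⟨ step N ⟩
  suc N * (suc N + 1) * (2 * suc N + 1)           ∎
  where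
  step : ∀ N → N * (N + 1) * (2 * N + 1) + 6 * (suc N * suc N) ≡ suc N * (suc N + 1) * (2 * suc N + 1)
  step = solve-∀

coprime-split : ∀ a b .{{_ : NonZero a}} →
  ∃[ g ] ∃[ a′ ] ∃[ b′ ] NonZero g × a ≡ a′ * g × b ≡ b′ * g × Coprime a′ b′
coprime-split a b =
  gcd a b , a / gcd a b , b / gcd a b , g≢0 ,
  sym (m/n*n≡m (gcd[m,n]∣m a b)) , sym (m/n*n≡m (gcd[m,n]∣n a b)) , coprime-/gcd a b
  where
  instance
    g≢0 : NonZero (gcd a b)
    g≢0 = ≢-nonZero (gcd[m,n]≢0 a b (inj₁ (≢-nonZero⁻¹ a)))

square-∣-square⇒∣ : ∀ a b .{{_ : NonZero a}} → a * a ∣ b * b → a ∣ b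
square-∣-square⇒∣ a b aa∣bb with coprime-split a b
... | g , a′ , b′ , g≢0 , refl , refl , cop = *-monoˡ-∣ g a′∣b′
  where
  instance _ = g≢0
  regroup : ∀ x g → x * g * (x * g) ≡ x * x * (g * g)
  regroup = solve-∀
  a′∣b′ : a′ ∣ b′
  a′∣b′ = coprime-divisor cop (∣-trans (m∣m*n a′)
            (*-cancelʳ-∣ (g * g) {{m*n≢0 g g}} (subst₂ _∣_ (regroup a′ g) (regroup b′ g) aa∣bb)))

squarefree-∣-square⇒∣ : ∀ {P c} → SquareFree P → P ∣ c * c → P ∣ c
squarefree-∣-square⇒∣ {zero} sf _ with () ← sf 0 (0 ∣0)
squarefree-∣-square⇒∣ {P@(suc _)} {c} sf P∣cc with coprime-split P c
... | g , P′ , c′ , g≢0 , P≡ , refl , cop = subst (_∣ c′ * g) (sym P≡g) (n∣m*n c′)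
  where
  instance _ = g≢0
  regroup : ∀ x g → x * g * (x * g) ≡ x * (x * g) * g
  regroup = solve-∀
  P′∣g : P′ ∣ g
  P′∣g = coprime-divisor cop (coprime-divisor cop
           (*-cancelʳ-∣ g (subst₂ _∣_ P≡ (regroup c′ g) P∣cc)))
  P′≡1 : P′ ≡ 1
  P′≡1 = sf P′ (subst (P′ * P′ ∣_) (sym P≡) (*-monoʳ-∣ P′ P′∣g))
  P≡g : P ≡ g
  P≡g = trans P≡ (trans (cong (_* g) P′≡1) (*-identityˡ g))

squarefree*square-∣-square⇒∣ : ∀ {P D k} .{{_ : NonZero D}} → SquareFree P →
  P * (D * D) ∣ k * k → P * D ∣ k
squarefree*square-∣-square⇒∣ {P} {D} {k} sf PDD∣kk
  with square-∣-square⇒∣ D k (∣-trans (n∣m*n P) PDD∣kk)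
... | divides c refl = *-monoˡ-∣ D (squarefree-∣-square⇒∣ {c = c} sf
        (*-cancelʳ-∣ (D * D) {{m*n≢0 D D}} (subst (P * (D * D) ∣_) (regroup c D) PDD∣kk)))
  where
  regroup : ∀ c D → c * D * (c * D) ≡ c * c * (D * D)
  regroup = solve-∀

∣⇒*square-∣-square : ∀ {P D k} → P * D ∣ k → P * (D * D) ∣ k * k
∣⇒*square-∣-square {P} {D} (divides c refl) = divides (c * c * P) (regroup P D c)
  where
  regroup : ∀ P D c → c * (P * D) * (c * (P * D)) ≡ c * c * P * (P * (D * D))
  regroup = solve-∀

count-zero-square-residues : ∀ {P D n} .{{_ : NonZero n}} → SquareFree P → n ≡ P * (D * D) →
  ∀ Q → sum1 (P * D * Q) (λ k → χ (k * k % n ≟ 0)) ≡ Q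
count-zero-square-residues {P} {D} {n} sf n≡ Q = begin
  sum1 (P * D * Q) (λ k → χ (k * k % n ≟ 0))
    ≡⟨ sum1-cong (P * D * Q) (λ k _ _ → χ-cong (to k) (from k) (k * k % n ≟ 0) (P * D ∣? k)) ⟩
  sum1 (P * D * Q) (λ k → χ (P * D ∣? k))
    ≡⟨ count-multiples (P * D) Q ⟩
  Q ∎
  where
  instance
    PDD≢0 : NonZero (P * (D * D))
    PDD≢0 = ≢-nonZero λ PDD≡0 → ≢-nonZero⁻¹ n (trans n≡ PDD≡0)
    DD≢0 : NonZero (D * D)
    DD≢0 = m*n≢0⇒n≢0 P
    D≢0 : NonZero D
    D≢0 = m*n≢0⇒m≢0 D
    P≢0 : NonZero P
    P≢0 = m*n≢0⇒m≢0 P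
    PD≢0 : NonZero (P * D)
    PD≢0 = m*n≢0 P D
  to : ∀ k → k * k % n ≡ 0 → P * D ∣ k
  to k kk%n≡0 = squarefree*square-∣-square⇒∣ sf (subst (_∣ k * k) n≡ (m%n≡0⇒n∣m (k * k) n kk%n≡0))
  from : ∀ k → P * D ∣ k → k * k % n ≡ 0
  from k PD∣k = n∣m⇒m%n≡0 (k * k) n (subst (_∣ k * k) (sym n≡) (∣⇒*square-∣-square {P} {D} PD∣k))

counts⇒cleared-identity : ∀ m S X R Q → S + X ≡ m * 2 * m →
  sum1 (m * 2) (λ k → k * k) ≡ m * 4 * X + R + m * 4 * Q → ClearedIdentity (m * 4) S R Q
counts⇒cleared-identity m S X R Q S+X≡ sum≡ = +-cancelʳ-≡ (24 * (n * X)) _ _ (begin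
  n * (24 * S + (n + 1) * (n + 2)) + 24 * (n * X)
    ≡⟨ collect-X n S X ⟩
  24 * n * (S + X) + n * (n + 1) * (n + 2)
    ≡⟨ cong (λ v → 24 * n * v + n * (n + 1) * (n + 2)) S+X≡ ⟩
  24 * n * (m * 2 * m) + n * (n + 1) * (n + 2)
    ≡⟨ in-m m ⟩
  3 * (n * n * n) + 4 * (m * 2 * (m * 2 + 1) * (2 * (m * 2) + 1))
    ≡⟨ cong (λ v → 3 * (n * n * n) + 4 * v) (sum-squares (m * 2)) ⟨
  3 * (n * n * n) + 4 * (6 * sum1 (m * 2) (λ k → k * k))
    ≡⟨ cong (λ v → 3 * (n * n * n) + 4 * (6 * v)) sum≡ ⟩
  3 * (n * n * n) + 4 * (6 * (n * X + R + n * Q))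
    ≡⟨ expand n X R Q ⟩
  n * (3 * (n * n) + 24 * Q) + 24 * R + 24 * (n * X) ∎)
  where
  n = m * 4
  collect-X : ∀ n S X → n * (24 * S + (n + 1) * (n + 2)) + 24 * (n * X) ≡
                        24 * n * (S + X) + n * (n + 1) * (n + 2)
  collect-X = solve-∀
  in-m : ∀ m → 24 * (m * 4) * (m * 2 * m) + m * 4 * (m * 4 + 1) * (m * 4 + 2) ≡
               3 * (m * 4 * (m * 4) * (m * 4)) + 4 * (m * 2 * (m * 2 + 1) * (2 * (m * 2) + 1))
  in-m = solve-∀
  expand : ∀ n X R Q → 3 * (n * n * n) + 4 * (6 * (n * X + R + n * Q)) ≡
                       n * (3 * (n * n) + 24 * Q) + 24 * R + 24 * (n * X)
  expand = solve-∀

cleared-identity-of-sums : ∀ m {P Q} .{{_ : NonZero (m * 4)}} → SquareFree P → m ≡ P * (Q * Q) →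
  ClearedIdentity (m * 4) (sum1 m (λ j → isqrt (j * (m * 4)))) (sum1 (m * 2) (λ k → k * k % (m * 4))) Q
cleared-identity-of-sums m {P} {Q} sf m≡PQ² =
  counts⇒cleared-identity m _ X _ Q (lattice-count (m * 2) m (N²≡mn m))
    (trans (sum-squares-by-residues (m * 2)) (cong (λ z → n * X + R + n * z) zeros≡Q))
  where
  n = m * 4
  X = sum1 (m * 2) (λ k → pred (k * k) / n)
  R = sum1 (m * 2) (λ k → k * k % n)
  N²≡mn : ∀ m → m * 2 * (m * 2) ≡ m * (m * 4)
  N²≡mn = solve-∀
  2m≡ : ∀ P Q → P * (Q * Q) * 2 ≡ P * (2 * Q) * Q
  2m≡ = solve-∀
  4m≡ : ∀ P Q → P * (Q * Q) * 4 ≡ P * (2 * Q * (2 * Q))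
  4m≡ = solve-∀
  zeros≡Q : sum1 (m * 2) (λ k → χ (k * k % n ≟ 0)) ≡ Q
  zeros≡Q = trans (cong (λ v → sum1 v (λ k → χ (k * k % n ≟ 0))) (trans (cong (_* 2) m≡PQ²) (2m≡ P Q)))
                  (count-zero-square-residues sf (trans (cong (_* 4) m≡PQ²) (4m≡ P Q)) Q)

corollary2p2 : (n : ℕ) → .{{_ : NonZero n}} → 4 ∣ n →
    (P Q : ℕ) → SquareFree P → 1 ≤ Q → n / 4 ≡ P * (Q * Q) →
    f n ≡ (ℚ.- ((+ n) ℚ./ 8)) ℚ.+ ℕtoℚ Q ℚ.+ ((+ remSum n) ℚ./ n)
-- The hypothesis 1 ≤ Q is redundant: Q ≡ 0 would force n ≡ 0.
corollary2p2 _ (divides m refl) P Q sf _ n/4≡PQ² = begin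
  f n
    ≡⟨ cong (λ v → ℕtoℚ (sum1 v (λ j → isqrt (j * n))) ℚ.- c) n/4≡m ⟩
  ℕtoℚ S ℚ.- c
    ≡⟨ cleared-identity⇒ℚ n S R Q (cleared-identity-of-sums m {P} {Q} sf (trans (sym n/4≡m) n/4≡PQ²)) ⟩
  ℚ.- b ℚ.+ ℕtoℚ Q ℚ.+ ((+ R) ℚ./ n)
    ≡⟨ cong (λ v → ℚ.- b ℚ.+ ℕtoℚ Q ℚ.+ ((+ sum1 v (λ k → k * k % n)) ℚ./ n)) n/2≡2m ⟨
  ℚ.- b ℚ.+ ℕtoℚ Q ℚ.+ ((+ remSum n) ℚ./ n) ∎
  where
  n = m * 4
  S = sum1 m (λ j → isqrt (j * n))
  R = sum1 (m * 2) (λ k → k * k % n)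
  b = (+ n) ℚ./ 8
  c = (+ (n * n) ℤ.- + 1) ℚ./ 12
  n/4≡m : n / 4 ≡ m
  n/4≡m = m*n/n≡m m 4
  n/2≡2m : n / 2 ≡ m * 2
  n/2≡2m = trans (/-congˡ (sym (*-assoc m 2 2))) (m*n/n≡m (m * 2) 2)
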